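{- For every finite undirected graph $G=(V,E)$ and every threshold function $t:V\to\mathbb{N}$, every execution of the algorithm MTS on input $(G,t)$ outputs a target set $S$ with $$|S|\le\sum_{v\in V}\min\left(1,\frac{t(v)}{d(v)+1}\right),$$ where $d(v)$ is the degree of $v$ in $G$.
   Context: Graphs are finite, without loops. An undirected graph is treated as the bidirected digraph in which each edge $\{u,v\}$ is replaced by the two arcs $(u,v),(v,u)$. For a digraph $G=(V,E)$ and $v\in V$, $\Gamma^{in}(v)=\{u:(u,v)\in E\}$ and $\Gamma^{out}(v)=\{u:(v,u)\in E\}$. Given thresholds $t:V\to\mathbb{N}=\{0,1,2,\dots\}$ and $S\subseteq V$, the activation process starting at $S$ is $A_0=S$ and $A_\ell=A_{\ell-1}\cup\{u\in V: |\Gamma^{in}(u)\cap A_{\ell-1}|\ge t(u)\}$ for $\ell\ge1$. $S$ is a target set for $(G,t)$ if $A_\lambda=V$ for some $\lambda\ge0$. Algorithm MTS on input $(G,t)$: set $S=\emptyset$, $L=\emptyset$, $U=V$, and for each $v\in V$ set $k(v)=t(v)$, $\delta(v)=|\Gamma^{in}(v)|$. While $U\neq\emptyset$, perform one iteration as follows. Case 1: if some $v\in U$ has $k(v)=0$, select such a $v$; for each $u\in\Gamma^{out}(v)\cap U$ set $k(u)=\max(k(u)-1,0)$ and, if $v\notin L$, set $\delta(u)=\delta(u)-1$; then set $U=U\setminus\{v\}$. Case 2: otherwise, if some $v\in U\setminus L$ has $\delta(v)<k(v)$, select such a $v$; set $S=S\cup\{v\}$; for each $u\in\Gamma^{out}(v)\cap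 U$ set $k(u)=k(u)-1$ and $\delta(u)=\delta(u)-1$; then set $U=U\setminus\{v\}$. Case 3: otherwise, select $v\in U\setminus L$ maximizing $\frac{k(u)}{\delta(u)(\delta(u)+1)}$ over $u\in U\setminus L$; for each $u\in\Gamma^{out}(v)\cap U$ set $\delta(u)=\delta(u)-1$; set $L=L\cup\{v\}$. When $U=\emptyset$, return $S$. Whenever several nodes qualify in a case, one of them is chosen arbitrarily. -}

module Defs where

open import Data.Nat using (ℕ; zero; suc; _*_; _∸_; _⊔_; _≤_; _<_; _≤ᵇ_; _≟_)
open import Data.Bool using (Bool; true; false; if_then_else_; _∧_; not)
open import Data.Fin using (Fin)
import Data.Fin as Fin
open import Data.Fin.Subset using (Subset; ⊤; ⊥; _∈_; _∉_; _∩_; _∪_; _-_; ∣_∣; ⁅_⁆)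
open import Data.Vec using (tabulate; lookup)
open import Data.Product using (Σ; ∃; _×_; _,_)
open import Data.Sum using (_⊎_)
open import Data.Integer using (+_)
open import Data.Rational using (ℚ; _/_; _⊓_; 1ℚ; 0ℚ; _+_)
open import Relation.Binary.PropositionalEquality using (_≡_)
open import Relation.Nullary using (¬_)

record Graph (n : ℕ) : Set where
  field
    adj   : Fin n → Fin n → Bool
    sym   : ∀ u v → adj u v ≡ adj v u
    loopless : ∀ v → adj v v ≡ false
open Graph public

-- Neighbourhood Γ(v) (= Γ^in(v) = Γ^out(v) for the bidirected digraph).
Γ : ∀ {n} → Graph n → Fin n → Subset n
Γ G v = tabulate (adj G v)

deg : ∀ {n} → Graph n → Fin n → ℕ
deg G v = ∣ Γ G v ∣

Thresholds : ℕ → Set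
Thresholds n = Fin n → ℕ

activated : ∀ {n} → Graph n → Thresholds n → Subset n → ℕ → Subset n
activated G t S zero    = S
activated G t S (suc ℓ) =
  activated G t S ℓ ∪ tabulate (λ u → t u ≤ᵇ ∣ Γ G u ∩ activated G t S ℓ ∣)

IsTargetSet : ∀ {n} → Graph n → Thresholds n → Subset n → Set
IsTargetSet G t S = ∃ λ λ' → activated G t S λ' ≡ ⊤

record MTSState (n : ℕ) : Set where
  constructor mkState
  field
    S L U : Subset n
    k δ   : Fin n → ℕ
open MTSState public

initState : ∀ {n} → Graph n → Thresholds n → MTSState n
initState G t = mkState ⊥ ⊥ ⊤ t (deg G)

touched : ∀ {n} → Graph n → Subset n → Fin n → Fin n → Bool
touched G U v u = adj G v u ∧ lookup U u

InUL : ∀ {n} → MTSState n → Fin n → Set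
InUL st u = u ∈ U st × u ∉ L st

-- k(u)/(δ(u)(δ(u)+1)) ≤ k(v)/(δ(v)(δ(v)+1)), cross-multiplied
-- (all denominators are positive whenever Case 3 applies).
RatioLe : ∀ {n} → MTSState n → Fin n → Fin n → Set
RatioLe st u v =
  k st u * (δ st v * suc (δ st v)) ≤ k st v * (δ st u * suc (δ st u))

case1 : ∀ {n} → Graph n → MTSState n → Fin n → MTSState n
case1 G (mkState S L U k δ) v =
  mkState S L (U - v)
    (λ u → if touched G U v u then k u ∸ 1 else k u)
    (λ u → if touched G U v u ∧ not (lookup L v) then δ u ∸ 1 else δ u)

case2 : ∀ {n} → Graph n → MTSState n → Fin n → MTSState n
case2 G (mkState S L U k δ) v =
  mkState (S ∪ ⁅ v ⁆) L (U - v)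
    (λ u → if touched G U v u then k u ∸ 1 else k u)
    (λ u → if touched G U v u then δ u ∸ 1 else δ u)

case3 : ∀ {n} → Graph n → MTSState n → Fin n → MTSState n
case3 G (mkState S L U k δ) v =
  mkState S (L ∪ ⁅ v ⁆) U k
    (λ u → if touched G U v u then δ u ∸ 1 else δ u)

-- One iteration of the while loop, with arbitrary choice among qualifying nodes.
data Step {n : ℕ} (G : Graph n) : MTSState n → MTSState n → Set where
  step1 : ∀ st v → v ∈ U st → k st v ≡ 0 →
          Step G st (case1 G st v)
  step2 : ∀ st v →
          (∀ u → u ∈ U st → ¬ (k st u ≡ 0)) →
          InUL st v → δ st v < k st v →
          Step G st (case2 G st v)
  step3 : ∀ st v →
          (∀ u → u ∈ U st → ¬ (k st u ≡ 0)) →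
          (∀ u → InUL st u → ¬ (δ st u < k st u)) →
          InUL st v → (∀ u → InUL st u → RatioLe st u v) →
          Step G st (case3 G st v)

data Reachable {n : ℕ} (G : Graph n) (t : Thresholds n) : MTSState n → Set where
  start : Reachable G t (initState G t)
  next  : ∀ {st st'} → Reachable G t st → ¬ (U st ≡ ⊥) → Step G st st' →
          Reachable G t st'

sumFin : ∀ n → (Fin n → ℚ) → ℚ
sumFin zero    f = 0ℚ
sumFin (suc n) f = f Fin.zero + sumFin n (λ i → f (Fin.suc i))

bound : ∀ {n} → Graph n → Thresholds n → ℚ
bound {n} G t = sumFin n (λ v → 1ℚ ⊓ ((+ t v) / suc (deg G v)))

module Submission where

-- The potential |S| + Σ_{v ∈ U∖L} min(1, k(v)/(δ(v)+1)) equals the bound initially (k = t, δ = d)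
-- and never increases.  Removing a vertex only decrements k and δ of its neighbours; in Case 2
-- the removed vertex has δ < k, so its term is 1 and pays for its entry into S.  In Case 3 the
-- term k(v)/(δ(v)+1) of v is split into δ(v) shares k(v)/(δ(v)(δ(v)+1)), and by the maximality of
-- v each active neighbour w, whose δ drops by one, gains at most k(w)/(δ(w)(δ(w)+1)) ≤ one share.
-- When U = ∅ the potential is |S|.  S is a target set because every removed vertex is in S or had
-- its threshold met by neighbours removed earlier, which are activated by induction.  The loop
-- never gets stuck: if U ⊆ L, the vertex of U that entered L last has k = 0.

module Rational where
  import Data.Nat.Solver
  import Data.Integer.Solver
  open import Data.Nat as ℕ using (ℕ; zero; suc; _∸_)
  import Data.Nat.Properties as ℕ
  module ℕS = Data.Nat.Solver.+-*-Solver
  module ℤS = Data.Integer.Solver.+-*-Solver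
  open import Data.Integer as ℤ using (+_)
  import Data.Integer.Properties as ℤ
  import Data.Rational.Unnormalised as ℚᵘ
  import Data.Rational.Unnormalised.Properties as ℚᵘ
  open import Data.Rational using (ℚ; 0ℚ; 1ℚ; _/_; _+_; -_; _≤_; _⊓_; +-0-rawMonoid)
  open import Data.Rational.Properties
  open import Algebra.Definitions.RawMonoid +-0-rawMonoid using (_×_)
  open import Relation.Binary.PropositionalEquality
  open import Data.Bool using (Bool; true; false; if_then_else_)
  open import Data.Fin as Fin using (Fin)
  open import Data.Fin.Subset using (∣_∣)
  open import Data.Vec using (tabulate)
  open import Function using (_∘_)
  open import Algebra.Properties.CommutativeMonoid.Sum +-0-commutativeMonoid using (sum)
  open import Defs using (sumFin)
  open import Relation.Nullary using (yes; no)

  -- toℚᵘ (+ a / suc b) is the unnormalised fraction mkℚᵘ (+ a) b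
  /-mono-≤ : ∀ a b c d .{{_ : ℕ.NonZero b}} .{{_ : ℕ.NonZero d}} → a ℕ.* d ℕ.≤ c ℕ.* b → + a / b ≤ + c / d
  /-mono-≤ a (suc b) c (suc d) h = toℚᵘ-cancel-≤
    (ℚᵘ.≤-respʳ-≃ (ℚᵘ.≃-sym (toℚᵘ-fromℚᵘ (ℚᵘ.mkℚᵘ (+ c) d)))
      (ℚᵘ.≤-respˡ-≃ (ℚᵘ.≃-sym (toℚᵘ-fromℚᵘ (ℚᵘ.mkℚᵘ (+ a) b)))
        (ℚᵘ.*≤* (subst₂ ℤ._≤_ (ℤ.pos-* a (suc d)) (ℤ.pos-* c (suc b)) (ℤ.+≤+ h)))))

  /-cong-≡ : ∀ a b c d .{{_ : ℕ.NonZero b}} .{{_ : ℕ.NonZero d}} → a ℕ.* d ≡ c ℕ.* b → + a / b ≡ + c / d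
  /-cong-≡ a b c d h = ≤-antisym (/-mono-≤ a b c d (ℕ.≤-reflexive h)) (/-mono-≤ c d a b (ℕ.≤-reflexive (sym h)))

  /-distribʳ-+ : ∀ a c d → + (a ℕ.+ c) / suc d ≡ + a / suc d + + c / suc d
  /-distribʳ-+ a c d = sym (toℚᵘ-injective (ℚᵘ.≃-trans (toℚᵘ-homo-+ (+ a / suc d) (+ c / suc d))
    (ℚᵘ.≃-trans (ℚᵘ.+-cong (toℚᵘ-fromℚᵘ (ℚᵘ.mkℚᵘ (+ a) d)) (toℚᵘ-fromℚᵘ (ℚᵘ.mkℚᵘ (+ c) d)))
      (ℚᵘ.≃-trans (ℚᵘ.*≡* cross) (ℚᵘ.≃-sym (toℚᵘ-fromℚᵘ (ℚᵘ.mkℚᵘ (+ (a ℕ.+ c)) d)))))))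
    where
    open ℤS
    cross : (+ a ℤ.* + suc d ℤ.+ + c ℤ.* + suc d) ℤ.* + suc d ≡ + (a ℕ.+ c) ℤ.* + (suc d ℕ.* suc d)
    cross = trans (solve 3 (λ a c s → (a :* s :+ c :* s) :* s := (a :+ c) :* (s :* s)) refl (+ a) (+ c) (+ suc d))
                  (sym (cong₂ ℤ._*_ (ℤ.pos-+ a c) (ℤ.pos-* (suc d) (suc d))))

  ×-/ : ∀ m a d → m × (+ a / suc d) ≡ + (m ℕ.* a) / suc d
  ×-/ zero    a d = sym (0/n≡0 (suc d))
  ×-/ (suc m) a d = trans (cong (_+_ (+ a / suc d)) (×-/ m a d)) (sym (/-distribʳ-+ a (m ℕ.* a) d))

  -- opaque, so that the normalising division inside is never unfolded in goals
  opaque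
    vertexBound : ℕ → ℕ → ℚ
    vertexBound k δ = 1ℚ ⊓ (+ k / suc δ)

  opaque
    unfolding vertexBound

    vertexBound-def : ∀ k δ → vertexBound k δ ≡ 1ℚ ⊓ (+ k / suc δ)
    vertexBound-def k δ = refl

    vertexBound≤1 : ∀ k δ → vertexBound k δ ≤ 1ℚ
    vertexBound≤1 k δ = p⊓q≤p 1ℚ (+ k / suc δ)

    vertexBound≤/ : ∀ k δ → vertexBound k δ ≤ + k / suc δ
    vertexBound≤/ k δ = p⊓q≤q 1ℚ (+ k / suc δ)

    0≤vertexBound : ∀ k δ → 0ℚ ≤ vertexBound k δ
    0≤vertexBound k δ = ⊓-glb (/-mono-≤ 0 1 1 1 ℕ.z≤n) (/-mono-≤ 0 1 k (suc δ) ℕ.z≤n)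

    vertexBound-zero : ∀ δ → vertexBound 0 δ ≡ 0ℚ
    vertexBound-zero δ = trans (p≥q⇒p⊓q≡q (/-mono-≤ 0 (suc δ) 1 1 ℕ.z≤n)) (0/n≡0 (suc δ))

    vertexBound-saturated : ∀ k δ → δ ℕ.< k → vertexBound k δ ≡ 1ℚ
    vertexBound-saturated k δ δ<k = p≤q⇒p⊓q≡p (/-mono-≤ 1 1 k (suc δ)
      (subst₂ ℕ._≤_ (sym (ℕ.*-identityˡ (suc δ))) (sym (ℕ.*-identityʳ k)) δ<k))

    vertexBound-unsaturated : ∀ k δ → k ℕ.≤ suc δ → vertexBound k δ ≡ + k / suc δ
    vertexBound-unsaturated k δ k≤1+δ = p≥q⇒p⊓q≡q (/-mono-≤ k (suc δ) 1 1
      (subst₂ ℕ._≤_ (sym (ℕ.*-identityʳ k)) (sym (ℕ.*-identityˡ (suc δ))) k≤1+δ))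

    vertexBound-monoˡ-≤ : ∀ {k k′} δ → k ℕ.≤ k′ → vertexBound k δ ≤ vertexBound k′ δ
    vertexBound-monoˡ-≤ {k} {k′} δ k≤k′ =
      ⊓-monoʳ-≤ 1ℚ (/-mono-≤ k (suc δ) k′ (suc δ) (ℕ.*-monoˡ-≤ (suc δ) k≤k′))

  vertexBound-pred : ∀ k δ → vertexBound (k ∸ 1) δ ≤ vertexBound k δ
  vertexBound-pred k δ = vertexBound-monoˡ-≤ δ (ℕ.m∸n≤m k 1)

  vertexBound-pred-pred : ∀ k δ → vertexBound (k ∸ 1) (δ ∸ 1) ≤ vertexBound k δ
  vertexBound-pred-pred zero    δ       = ≤-reflexive (trans (vertexBound-zero (δ ∸ 1)) (sym (vertexBound-zero δ)))
  vertexBound-pred-pred (suc k) zero    = ≤-trans (vertexBound≤1 k 0)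
    (≤-reflexive (sym (vertexBound-saturated (suc k) 0 (ℕ.s≤s ℕ.z≤n))))
  vertexBound-pred-pred (suc k) (suc δ) with k ℕ.≤? δ
  ... | no  k≰δ = ≤-trans (vertexBound≤1 k δ)
    (≤-reflexive (sym (vertexBound-saturated (suc k) (suc δ) (ℕ.s≤s (ℕ.≰⇒> k≰δ)))))
  ... | yes k≤δ = begin
    vertexBound k δ                  ≤⟨ vertexBound≤/ k δ ⟩
    + k / suc δ                      ≤⟨ /-mono-≤ k (suc δ) (suc k) (suc (suc δ)) cross ⟩
    + suc k / suc (suc δ)            ≡⟨ vertexBound-unsaturated (suc k) (suc δ) (ℕ.s≤s (ℕ.m≤n⇒m≤1+n k≤δ)) ⟨
    vertexBound (suc k) (suc δ)      ∎
    where
    open ≤-Reasoning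
    cross : k ℕ.* suc (suc δ) ℕ.≤ suc k ℕ.* suc δ
    cross = subst (ℕ._≤ suc k ℕ.* suc δ) (sym (ℕ.*-suc k (suc δ)))
                  (ℕ.+-monoˡ-≤ (k ℕ.* suc δ) (ℕ.m≤n⇒m≤1+n k≤δ))

  /-split : ∀ k m → + k / suc m ≡ + k / suc (suc m) + + k / (suc m ℕ.* suc (suc m))
  /-split k m = begin
    + k / suc m                                            ≡⟨ /-cong-≡ k (suc m) (k ℕ.* suc m ℕ.+ k) (suc m ℕ.* suc (suc m)) eq₁ ⟩
    + (k ℕ.* suc m ℕ.+ k) / (suc m ℕ.* suc (suc m))       ≡⟨ /-distribʳ-+ (k ℕ.* suc m) k _ ⟩
    + (k ℕ.* suc m) / (suc m ℕ.* suc (suc m)) + + k / _   ≡⟨ cong (_+ (+ k / (suc m ℕ.* suc (suc m))))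
                                                                (/-cong-≡ (k ℕ.* suc m) (suc m ℕ.* suc (suc m)) k (suc (suc m)) eq₂) ⟩
    + k / suc (suc m) + + k / (suc m ℕ.* suc (suc m))     ∎
    where
    open ≡-Reasoning
    open ℕS
    eq₁ : k ℕ.* (suc m ℕ.* suc (suc m)) ≡ (k ℕ.* suc m ℕ.+ k) ℕ.* suc m
    eq₁ = solve 2 (λ k m → k :* ((con 1 :+ m) :* (con 2 :+ m)) := (k :* (con 1 :+ m) :+ k) :* (con 1 :+ m)) refl k m
    eq₂ : k ℕ.* suc m ℕ.* suc (suc m) ≡ k ℕ.* (suc m ℕ.* suc (suc m))
    eq₂ = solve 2 (λ k m → k :* (con 1 :+ m) :* (con 2 :+ m) := k :* ((con 1 :+ m) :* (con 2 :+ m))) refl k m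

  -- the part of k / (δ + 1) passed on to each of the δ = e + 1 neighbours: k / (δ (δ + 1))
  opaque
    share : ℕ → ℕ → ℚ
    share k e = + k / (suc e ℕ.* suc (suc e))

  opaque
    unfolding share

    vertexBound≤vertexBound-suc+share : ∀ k m a e → k ℕ.≤ suc m →
      k ℕ.* (suc e ℕ.* suc (suc e)) ℕ.≤ a ℕ.* (suc m ℕ.* suc (suc m)) →
      vertexBound k m ≤ vertexBound k (suc m) + share a e
    vertexBound≤vertexBound-suc+share k m a e k≤1+m ratio = begin
      vertexBound k m                                        ≤⟨ vertexBound≤/ k m ⟩
      + k / suc m                                            ≡⟨ /-split k m ⟩
      + k / suc (suc m) + + k / (suc m ℕ.* suc (suc m))     ≤⟨ +-mono-≤ (≤-reflexive unsaturated)
                                                                (/-mono-≤ k (suc m ℕ.* suc (suc m)) a (suc e ℕ.* suc (suc e)) ratio) ⟩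
      vertexBound k (suc m) + share a e                      ∎
      where
      open ≤-Reasoning
      unsaturated : + k / suc (suc m) ≡ vertexBound k (suc m)
      unsaturated = sym (vertexBound-unsaturated k (suc m) (ℕ.m≤n⇒m≤1+n k≤1+m))

    ×-share≡vertexBound : ∀ k e → k ℕ.≤ suc e → suc e × share k e ≡ vertexBound k (suc e)
    ×-share≡vertexBound k e k≤1+e = begin
      suc e × share k e                          ≡⟨ ×-/ (suc e) k _ ⟩
      + (suc e ℕ.* k) / (suc e ℕ.* suc (suc e))  ≡⟨ /-cong-≡ (suc e ℕ.* k) (suc e ℕ.* suc (suc e)) k (suc (suc e)) eq ⟩
      + k / suc (suc e)                          ≡⟨ vertexBound-unsaturated k (suc e) (ℕ.m≤n⇒m≤1+n k≤1+e) ⟨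
      vertexBound k (suc e)                      ∎
      where
      open ≡-Reasoning
      open ℕS
      eq : suc e ℕ.* k ℕ.* suc (suc e) ≡ k ℕ.* (suc e ℕ.* suc (suc e))
      eq = solve 2 (λ k e → (con 1 :+ e) :* k :* (con 2 :+ e) := k :* ((con 1 :+ e) :* (con 2 :+ e))) refl k e

  vertexBound-decrement : ∀ b c k δ → (c ≡ true → b ≡ true) →
    vertexBound (if b then k ∸ 1 else k) (if c then δ ∸ 1 else δ) ≤ vertexBound k δ
  vertexBound-decrement false false k δ _   = ≤-refl
  vertexBound-decrement false true  k δ c⇒b with c⇒b refl
  ... | ()
  vertexBound-decrement true  false k δ _   = vertexBound-pred k δ
  vertexBound-decrement true  true  k δ _   = vertexBound-pred-pred k δ

  sumFin≡sum : ∀ n (f : Fin n → ℚ) → sumFin n f ≡ sum f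
  sumFin≡sum zero    f = refl
  sumFin≡sum (suc n) f = cong (_+_ (f Fin.zero)) (sumFin≡sum n (f ∘ Fin.suc))

  sum-mono-≤ : ∀ {n} {f g : Fin n → ℚ} → (∀ i → f i ≤ g i) → sum f ≤ sum g
  sum-mono-≤ {zero}  f≤g = ≤-refl
  sum-mono-≤ {suc n} f≤g = +-mono-≤ (f≤g Fin.zero) (sum-mono-≤ (f≤g ∘ Fin.suc))

  sum-indicator : ∀ {n} (b : Fin n → Bool) x → sum (λ i → if b i then x else 0ℚ) ≡ ∣ tabulate b ∣ × x
  sum-indicator {zero}  b x = refl
  sum-indicator {suc n} b x with b Fin.zero
  ... | true  = cong (_+_ x) (sum-indicator (b ∘ Fin.suc) x)
  ... | false = trans (+-identityˡ _) (sum-indicator (b ∘ Fin.suc) x)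

  sum-indicator-single : ∀ {n} (b : Fin n → Bool) x → ∣ tabulate b ∣ ≡ 1 →
                        sum (λ i → if b i then x else 0ℚ) ≡ x
  sum-indicator-single b x ∣b∣≡1 = trans (sum-indicator b x) (trans (cong (_× x) ∣b∣≡1) (+-identityʳ x))

  sum-indicator-share : ∀ {n} (b : Fin n → Bool) k e → ∣ tabulate b ∣ ≡ suc e → k ℕ.≤ suc e →
    sum (λ i → if b i then share k e else 0ℚ) ≡ vertexBound k (suc e)
  sum-indicator-share b k e ∣b∣≡1+e k≤1+e =
    trans (sum-indicator b _) (trans (cong (_× _) ∣b∣≡1+e) (×-share≡vertexBound k e k≤1+e))

  +-cancelʳ-≤ : ∀ {p q} r → p + r ≤ q + r → p ≤ q
  +-cancelʳ-≤ {p} {q} r p+r≤q+r = begin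
    p            ≡⟨ cancel p ⟨
    p + r + - r  ≤⟨ +-monoˡ-≤ (- r) p+r≤q+r ⟩
    q + r + - r  ≡⟨ cancel q ⟩
    q            ∎
    where
    open ≤-Reasoning
    cancel : ∀ x → x + r + - r ≡ x
    cancel x = trans (+-assoc x r (- r)) (trans (cong (_+_ x) (+-inverseʳ r)) (+-identityʳ x))

open import Data.Nat using (ℕ; zero; suc; _+_; _*_; _∸_; _≤_; _<_; _<ᵇ_; _≤ᵇ_; NonZero)
import Data.Nat.Properties as ℕ
open import Data.Nat.Solver using (module +-*-Solver)
open import Data.Bool as Bool using (Bool; true; false; not; _∧_; _∨_; if_then_else_)
open import Data.Bool.Properties using (∧-zeroʳ; ∧-identityʳ; ∨-zeroʳ; ∨-identityʳ; T-≡)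
open import Data.Fin using (Fin; zero; suc; _≟_)
open import Data.Fin.Properties using (suc-injective; any?)
open import Data.Fin.Subset using (Subset; ⊥; _∈_; _∉_; _⊆_; _─_; _-_; _∪_; _∩_; ⁅_⁆; ∣_∣)
open import Data.Fin.Subset.Properties
  using (x∈⁅x⁆; x≢y⇒x∉⁅y⁆; p⊆q⇒∣p∣≤∣q∣; p⊆p∪q; ∣⁅x⁆∣≡1; ∣⊥∣≡0; x∈p∪q⁺; x∈p∪q⁻; x∈p∩q⁺; x∈p∩q⁻; ⊆-antisym; ⊆⊤; nonempty?; Empty-unique)
open import Data.Vec using (_∷_; lookup; tabulate)
open import Data.Vec.Properties
  using ([]=⇒lookup; lookup⇒[]=; lookup-zipWith; lookup∘tabulate; tabulate∘lookup; tabulate-cong; lookup-replicate)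
open import Data.Product using (∃; _×_; _,_; proj₁; proj₂)
open import Data.Sum using (_⊎_; inj₁; inj₂; reduce)
open import Data.Integer using (+_)
import Data.Rational as ℚ
import Data.Rational.Properties as ℚ
open import Algebra.Properties.CommutativeMonoid.Sum ℚ.+-0-commutativeMonoid
  using (sum; ∑-distrib-+; sum-cong-≗; sum-replicate-zero)
open import Function using (_∘_; _$_)
open import Function.Bundles using (Equivalence)
open import Relation.Binary.PropositionalEquality using (_≡_; _≢_; refl; sym; trans; cong; cong₂; subst; module ≡-Reasoning)
open import Relation.Nullary using (¬_; yes; no; contradiction)
open import Relation.Nullary.Decidable using (_×-dec_)
open import Defs renaming (sym to adj-sym)

open Rational

private variable
  n : ℕ

∧-true⁻ : ∀ {a b} → a ∧ b ≡ true → a ≡ true × b ≡ true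
∧-true⁻ {true} b≡true = refl , b≡true

not≡true⁻ : ∀ {b} → not b ≡ true → b ≡ false
not≡true⁻ {false} _ = refl

≤⇒≤ᵇ≡true : ∀ {m n} → m ≤ n → (m ≤ᵇ n) ≡ true
≤⇒≤ᵇ≡true m≤n = Equivalence.to T-≡ (ℕ.≤⇒≤ᵇ m≤n)

<⇒<ᵇ≡true : ∀ {m n} → m < n → (m <ᵇ n) ≡ true
<⇒<ᵇ≡true m<n = Equivalence.to T-≡ (ℕ.<⇒<ᵇ m<n)

≤⇒<ᵇ≡false : ∀ {m n} → n ≤ m → (m <ᵇ n) ≡ false
≤⇒<ᵇ≡false {m} {n} n≤m with m <ᵇ n in eq
... | false = refl
... | true  = contradiction (ℕ.<ᵇ⇒< m n (Equivalence.from T-≡ eq)) (ℕ.≤⇒≯ n≤m)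

≤-+-pred-suc : ∀ {m} k o → m ≤ k + o → m ≤ k ∸ 1 + suc o
≤-+-pred-suc zero    o m≤o     = ℕ.m≤n⇒m≤1+n m≤o
≤-+-pred-suc {m} (suc k) o m≤1+k+o = subst (m ≤_) (sym (ℕ.+-suc k o)) m≤1+k+o

cross-≤-trans : ∀ a₁ a₂ a₃ d₁ d₂ d₃ .{{_ : NonZero (a₂ * d₂)}} →
                a₁ * d₂ ≤ a₂ * d₁ → a₂ * d₃ ≤ a₃ * d₂ → a₁ * d₃ ≤ a₃ * d₁
cross-≤-trans a₁ a₂ a₃ d₁ d₂ d₃ h₁ h₂ = ℕ.*-cancelʳ-≤ (a₁ * d₃) (a₃ * d₁) (a₂ * d₂) $ begin
  a₁ * d₃ * (a₂ * d₂)       ≡⟨ solve 4 (λ a₁ a₂ d₂ d₃ → a₁ :* d₃ :* (a₂ :* d₂) := (a₁ :* d₂) :* (a₂ :* d₃)) refl a₁ a₂ d₂ d₃ ⟩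
  (a₁ * d₂) * (a₂ * d₃)     ≤⟨ ℕ.*-mono-≤ h₁ h₂ ⟩
  (a₂ * d₁) * (a₃ * d₂)     ≡⟨ solve 4 (λ a₂ a₃ d₁ d₂ → (a₂ :* d₁) :* (a₃ :* d₂) := a₃ :* d₁ :* (a₂ :* d₂)) refl a₂ a₃ d₁ d₂ ⟩
  a₃ * d₁ * (a₂ * d₂)       ∎
  where
  open ℕ.≤-Reasoning
  open +-*-Solver

lookup-∉ : ∀ {x} {p : Subset n} → x ∉ p → lookup p x ≡ false
lookup-∉ {x = x} {p} x∉p with lookup p x in eq
... | false = refl
... | true  = contradiction (lookup⇒[]= x p eq) x∉p

lookup-⁅x⁆-x : ∀ (x : Fin n) → lookup ⁅ x ⁆ x ≡ true
lookup-⁅x⁆-x x = []=⇒lookup (x∈⁅x⁆ x)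

lookup-⁅x⁆-y : ∀ {x y : Fin n} → y ≢ x → lookup ⁅ x ⁆ y ≡ false
lookup-⁅x⁆-y y≢x = lookup-∉ (x≢y⇒x∉⁅y⁆ y≢x)

lookup-─ : ∀ (p q : Subset n) x → lookup (p ─ q) x ≡ lookup p x ∧ not (lookup q x)
lookup-─ (b ∷ p) (true  ∷ q) zero    = sym (∧-zeroʳ b)
lookup-─ (b ∷ p) (false ∷ q) zero    = sym (∧-identityʳ b)
lookup-─ (_ ∷ p) (_     ∷ q) (suc x) = lookup-─ p q x

lookup-∪ : ∀ (p q : Subset n) x → lookup (p ∪ q) x ≡ lookup p x ∨ lookup q x
lookup-∪ p q x = lookup-zipWith _∨_ x p q

lookup-remove-self : ∀ (p : Subset n) x → lookup (p - x) x ≡ false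
lookup-remove-self p x rewrite lookup-─ p ⁅ x ⁆ x | lookup-⁅x⁆-x x = ∧-zeroʳ (lookup p x)

lookup-remove-other : ∀ (p : Subset n) {x y} → y ≢ x → lookup (p - x) y ≡ lookup p y
lookup-remove-other p {x} {y} y≢x rewrite lookup-─ p ⁅ x ⁆ y | lookup-⁅x⁆-y y≢x = ∧-identityʳ (lookup p y)

lookup-insert-self : ∀ (p : Subset n) x → lookup (p ∪ ⁅ x ⁆) x ≡ true
lookup-insert-self p x rewrite lookup-∪ p ⁅ x ⁆ x | lookup-⁅x⁆-x x = ∨-zeroʳ (lookup p x)

lookup-insert-other : ∀ (p : Subset n) {x y} → y ≢ x → lookup (p ∪ ⁅ x ⁆) y ≡ lookup p y
lookup-insert-other p {x} {y} y≢x rewrite lookup-∪ p ⁅ x ⁆ y | lookup-⁅x⁆-y y≢x = ∨-identityʳ (lookup p y)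

∣tabulate∣-cong : ∀ {f g : Fin n → Bool} → (∀ i → f i ≡ g i) → ∣ tabulate f ∣ ≡ ∣ tabulate g ∣
∣tabulate∣-cong f≗g = cong ∣_∣ (tabulate-cong f≗g)

∣tabulate∣-cong-except : ∀ {f g : Fin n → Bool} x → (∀ i → i ≢ x → f i ≡ g i) → f x ≡ g x →
                         ∣ tabulate f ∣ ≡ ∣ tabulate g ∣
∣tabulate∣-cong-except {f = f} {g} x agree fx≡gx = ∣tabulate∣-cong pointwise
  where
  pointwise : ∀ i → f i ≡ g i
  pointwise i with i ≟ x
  ... | yes refl = fx≡gx
  ... | no  i≢x  = agree i i≢x

∣tabulate∣-remove : ∀ {f g : Fin n → Bool} x → (∀ i → i ≢ x → f i ≡ g i) → f x ≡ true → g x ≡ false →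
                    ∣ tabulate f ∣ ≡ suc ∣ tabulate g ∣
∣tabulate∣-remove zero agree fx gx rewrite fx | gx =
  cong suc (∣tabulate∣-cong (λ i → agree (suc i) λ ()))
∣tabulate∣-remove {g = g} (suc x) agree fx gx rewrite agree zero (λ ()) with g zero
... | true  = cong suc (∣tabulate∣-remove x (λ i i≢x → agree (suc i) (i≢x ∘ suc-injective)) fx gx)
... | false = ∣tabulate∣-remove x (λ i i≢x → agree (suc i) (i≢x ∘ suc-injective)) fx gx

∣tabulate∣-mono : ∀ {f g : Fin n → Bool} → (∀ i → f i ≡ true → g i ≡ true) → ∣ tabulate f ∣ ≤ ∣ tabulate g ∣
∣tabulate∣-mono {f = f} {g} f⇒g = p⊆q⇒∣p∣≤∣q∣ {p = tabulate f} λ {i} i∈f → lookup⇒[]= i (tabulate g)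
  (trans (lookup∘tabulate g i) (f⇒g i (trans (sym (lookup∘tabulate f i)) ([]=⇒lookup i∈f))))

∣tabulate∣-false : ∀ {f : Fin n → Bool} → (∀ i → f i ≡ false) → ∣ tabulate f ∣ ≡ 0
∣tabulate∣-false {zero}  _       = refl
∣tabulate∣-false {suc n} f≡false rewrite f≡false zero = ∣tabulate∣-false (f≡false ∘ suc)

∣p∪⁅x⁆∣≡1+∣p∣ : ∀ (p : Subset n) {x} → lookup p x ≡ false → ∣ p ∪ ⁅ x ⁆ ∣ ≡ suc ∣ p ∣
∣p∪⁅x⁆∣≡1+∣p∣ p {x} px = begin
  ∣ p ∪ ⁅ x ⁆ ∣                    ≡⟨ cong ∣_∣ (tabulate∘lookup (p ∪ ⁅ x ⁆)) ⟨
  ∣ tabulate (lookup (p ∪ ⁅ x ⁆)) ∣  ≡⟨ ∣tabulate∣-remove x (λ i i≢x → lookup-insert-other p i≢x) (lookup-insert-self p x) px ⟩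
  suc ∣ tabulate (lookup p) ∣       ≡⟨ cong (suc ∘ ∣_∣) (tabulate∘lookup p) ⟩
  suc ∣ p ∣                         ∎
  where open ≡-Reasoning

∣tabulate-lookup-⁅x⁆∣≡1 : ∀ (x : Fin n) → ∣ tabulate (lookup ⁅ x ⁆) ∣ ≡ 1
∣tabulate-lookup-⁅x⁆∣≡1 x = trans (cong ∣_∣ (tabulate∘lookup ⁅ x ⁆)) (∣⁅x⁆∣≡1 x)

IsMaximum : ∀ {ℓ} → (Fin n → Bool) → (Fin n → Fin n → Set ℓ) → Fin n → Set ℓ
IsMaximum P _≼_ m = P m ≡ true × (∀ u → P u ≡ true → u ≼ m)

argmax : ∀ {ℓ n} (P : Fin n → Bool) (_≼_ : Fin n → Fin n → Set ℓ) →
         (∀ {x y} → P x ≡ true → P y ≡ true → x ≼ y ⊎ y ≼ x) →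
         (∀ {x y z} → P y ≡ true → x ≼ y → y ≼ z → x ≼ z) →
         ∀ {x} → P x ≡ true → ∃ (IsMaximum P _≼_)
argmax {n = suc n} P _≼_ total trans′ {x} Px with any? (λ i → P (suc i) Bool.≟ true)
... | no none = zero , P0 , λ { zero P0 → reduce (total P0 P0) ; (suc u) Pu → contradiction (u , Pu) none }
  where
  P0 : P zero ≡ true
  P0 = only-zero x Px
    where
    only-zero : ∀ y → P y ≡ true → P zero ≡ true
    only-zero zero    Py = Py
    only-zero (suc y) Py = contradiction (y , Py) none
... | yes (_ , Px′) with argmax (P ∘ suc) (λ a b → suc a ≼ suc b) total trans′ Px′
...   | m , Pm , m-max with P zero in P0
...     | false = suc m , Pm , λ { zero Pu → contradiction (trans (sym Pu) P0) λ () ; (suc u) Pu → m-max u Pu }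
...     | true with total P0 Pm
...       | inj₁ 0≼m = suc m , Pm , λ { zero _ → 0≼m ; (suc u) Pu → m-max u Pu }
...       | inj₂ m≼0 = zero , P0 , λ { zero _ → reduce (total P0 P0) ; (suc u) Pu → trans′ Pm (m-max u Pu) m≼0 }

module _ {n} (G : Graph n) (t : Thresholds n) where

  private
    A : Subset n → ℕ → Subset n
    A = activated G t

  ∈-activated-suc : ∀ S ℓ {w} → w ∈ A S ℓ → w ∈ A S (suc ℓ)
  ∈-activated-suc S ℓ w∈ = x∈p∪q⁺ (inj₁ w∈)

  ∈-activated-threshold : ∀ S ℓ {w} → t w ≤ ∣ Γ G w ∩ A S ℓ ∣ → w ∈ A S (suc ℓ)
  ∈-activated-threshold S ℓ {w} t≤ = x∈p∪q⁺ (inj₂ (lookup⇒[]= w _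
    (trans (lookup∘tabulate (λ u → t u ≤ᵇ ∣ Γ G u ∩ A S ℓ ∣) w) (≤⇒≤ᵇ≡true t≤))))

  ∈-activated-seed : ∀ S ℓ {w} → w ∈ S → w ∈ A S ℓ
  ∈-activated-seed S zero    w∈S = w∈S
  ∈-activated-seed S (suc ℓ) w∈S = ∈-activated-suc S ℓ (∈-activated-seed S ℓ w∈S)

  activated-mono : ∀ {S S′} → S ⊆ S′ → ∀ ℓ → A S ℓ ⊆ A S′ ℓ
  activated-mono S⊆S′ zero    w∈ = S⊆S′ w∈
  activated-mono {S} {S′} S⊆S′ (suc ℓ) {w} w∈ with x∈p∪q⁻ (A S ℓ) _ w∈
  ... | inj₁ w∈old = ∈-activated-suc S′ ℓ (activated-mono S⊆S′ ℓ w∈old)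
  ... | inj₂ w∈new = ∈-activated-threshold S′ ℓ (ℕ.≤-trans t≤ (p⊆q⇒∣p∣≤∣q∣ Γ∩-mono))
    where
    t≤ : t w ≤ ∣ Γ G w ∩ A S ℓ ∣
    t≤ = ℕ.≤ᵇ⇒≤ _ _ (Equivalence.from T-≡
      (trans (sym (lookup∘tabulate (λ u → t u ≤ᵇ ∣ Γ G u ∩ A S ℓ ∣) w)) ([]=⇒lookup w∈new)))
    Γ∩-mono : Γ G w ∩ A S ℓ ⊆ Γ G w ∩ A S′ ℓ
    Γ∩-mono x∈ = let x∈Γ , x∈A = x∈p∩q⁻ (Γ G w) (A S ℓ) x∈ in x∈p∩q⁺ (x∈Γ , activated-mono S⊆S′ ℓ x∈A)

  nbrCount : Fin n → (Fin n → Bool) → ℕ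
  nbrCount u P = ∣ tabulate (λ w → adj G u w ∧ P w) ∣

  nbrCount-mono : ∀ u {P Q} → (∀ w → adj G u w ≡ true → P w ≡ true → Q w ≡ true) →
                  nbrCount u P ≤ nbrCount u Q
  nbrCount-mono u P⇒Q = ∣tabulate∣-mono λ w uw∧Pw →
    let uw , Pw = ∧-true⁻ uw∧Pw in cong₂ _∧_ uw (P⇒Q w uw Pw)

  nbrCount-clear : ∀ u v {P Q} → (∀ w → w ≢ v → P w ≡ Q w) → Q v ≡ false →
                   nbrCount u P ≡ (if adj G u v ∧ P v then suc (nbrCount u Q) else nbrCount u Q)
  nbrCount-clear u v {P} {Q} agree Qv = by-cases (adj G u v ∧ P v) refl
    where
    agree′ : ∀ w → w ≢ v → adj G u w ∧ P w ≡ adj G u w ∧ Q w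
    agree′ w w≢v = cong (adj G u w ∧_) (agree w w≢v)
    uv∧Qv : adj G u v ∧ Q v ≡ false
    uv∧Qv = trans (cong (adj G u v ∧_) Qv) (∧-zeroʳ (adj G u v))
    by-cases : ∀ b → adj G u v ∧ P v ≡ b → nbrCount u P ≡ (if b then suc (nbrCount u Q) else nbrCount u Q)
    by-cases true  uv∧Pv = ∣tabulate∣-remove v agree′ uv∧Pv uv∧Qv
    by-cases false uv∧Pv = ∣tabulate∣-cong-except v agree′ (trans uv∧Pv (sym uv∧Qv))

  δ-after-clear : ∀ {u v} P Q {b δ} → (∀ w → w ≢ v → P w ≡ Q w) → Q v ≡ false →
                  b ≡ adj G u v ∧ P v → δ ≡ nbrCount u P → (if b then δ ∸ 1 else δ) ≡ nbrCount u Q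
  δ-after-clear {u} {v} P Q agree Qv refl refl rewrite nbrCount-clear u v agree Qv with adj G u v ∧ P v
  ... | true  = refl
  ... | false = refl

  residual-after-clear : ∀ {u v} P Q {b κ m} → (∀ w → w ≢ v → P w ≡ Q w) → Q v ≡ false → P v ≡ true →
                         b ≡ adj G u v → m ≤ κ + nbrCount u Q → m ≤ (if b then κ ∸ 1 else κ) + nbrCount u P
  residual-after-clear {u} {v} P Q {κ = κ} agree Qv Pv refl m≤ rewrite nbrCount-clear u v agree Qv | Pv
    with adj G u v
  ... | true  = ≤-+-pred-suc κ _ m≤
  ... | false = m≤

  bound-after-clear : ∀ {u v} P Q {b κ} → (∀ w → w ≢ v → P w ≡ Q w) → Q v ≡ false →
                      b ≡ adj G u v → κ ≤ nbrCount u P → (if b then κ ∸ 1 else κ) ≤ nbrCount u Q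
  bound-after-clear {u} {v} P Q {κ = κ} agree Qv refl κ≤ rewrite nbrCount-clear u v agree Qv
    with adj G u v | P v
  ... | true  | true  = ℕ.∸-monoˡ-≤ 1 κ≤
  ... | true  | false = ℕ.≤-trans (ℕ.m∸n≤m κ 1) κ≤
  ... | false | _     = κ≤

  touched≡adj : ∀ (U : Subset n) {u} v → lookup U u ≡ true → touched G U v u ≡ adj G u v
  touched≡adj U {u} v Uu rewrite Uu = trans (∧-identityʳ (adj G v u)) (adj-sym G v u)

  active : MTSState n → Fin n → Bool
  active st w = lookup (U st) w ∧ not (lookup (L st) w)

  active⁻ : ∀ st w → active st w ≡ true → lookup (U st) w ≡ true × lookup (L st) w ≡ false
  active⁻ st w active-w = let Uw , ¬Lw = ∧-true⁻ {lookup (U st) w} active-w in Uw , not≡true⁻ ¬Lw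

  contribution : MTSState n → Fin n → ℚ.ℚ
  contribution st w = if active st w then vertexBound (k st w) (δ st w) else ℚ.0ℚ

  potential : MTSState n → ℚ.ℚ
  potential st = + ∣ S st ∣ ℚ./ 1 ℚ.+ sum (contribution st)

  -- rank is ghost state ordering the vertices of L by the time they entered L.  When u entered L
  -- it had k ≤ δ, and afterwards k(u) dropped with every removed neighbour; hence k-pending.
  pending : (Fin n → ℕ) → MTSState n → Fin n → Fin n → Bool
  pending rank st u w = lookup (U st) w ∧ (not (lookup (L st) w) ∨ (rank u <ᵇ rank w))

  record Invariant (st : MTSState n) : Set where
    field
      S-removed         : ∀ w → lookup (S st) w ≡ true → lookup (U st) w ≡ false
      δ-active          : ∀ u → lookup (U st) u ≡ true → δ st u ≡ nbrCount u (active st)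
      k-residual        : ∀ u → lookup (U st) u ≡ true → t u ≤ k st u + nbrCount u (not ∘ lookup (U st))
      removed-activated : ∃ λ ℓ → ∀ w → lookup (U st) w ≡ false → w ∈ activated G t (S st) ℓ
      rank              : Fin n → ℕ
      nextRank          : ℕ
      rank<nextRank     : ∀ u → lookup (L st) u ≡ true → rank u < nextRank
      k-pending         : ∀ u → lookup (U st) u ≡ true → lookup (L st) u ≡ true →
                          k st u ≤ nbrCount u (pending rank st u)
      potential≤bound   : potential st ℚ.≤ bound G t

  0≤contribution : ∀ st w → ℚ.0ℚ ℚ.≤ contribution st w
  0≤contribution st w with active st w
  ... | true  = 0≤vertexBound (k st w) (δ st w)
  ... | false = ℚ.≤-refl

  contribution-mono : ∀ st st′ w →
    (active st′ w ≡ true → active st w ≡ true × vertexBound (k st′ w) (δ st′ w) ℚ.≤ vertexBound (k st w) (δ st w)) →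
    contribution st′ w ℚ.≤ contribution st w
  contribution-mono st st′ w decreased with active st′ w
  ... | false = 0≤contribution st w
  ... | true with decreased refl
  ...   | active-w , ≤vertexBound rewrite active-w = ≤vertexBound

  contribution-active : ∀ st w → active st w ≡ true → contribution st w ≡ vertexBound (k st w) (δ st w)
  contribution-active st w active-w rewrite active-w = refl

  contribution-inactive : ∀ st w → active st w ≡ false → contribution st w ≡ ℚ.0ℚ
  contribution-inactive st w inactive-w rewrite inactive-w = refl

  ⊥-lookup-elim : ∀ {w} {A : Set} → lookup (⊥ {n}) w ≡ true → A
  ⊥-lookup-elim {w} ⊥w = contradiction (trans (sym ⊥w) (lookup-replicate w false)) λ ()

  initially-active : ∀ w → active (initState G t) w ≡ true
  initially-active w rewrite lookup-replicate w true | lookup-replicate w false = refl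

  initial-potential : potential (initState G t) ≡ bound G t
  initial-potential = begin
    + ∣ ⊥ {n} ∣ ℚ./ 1 ℚ.+ sum (contribution st₀)  ≡⟨ cong (λ m → + m ℚ./ 1 ℚ.+ sum (contribution st₀)) (∣⊥∣≡0 n) ⟩
    ℚ.0ℚ ℚ.+ sum (contribution st₀)              ≡⟨ ℚ.+-identityˡ _ ⟩
    sum (contribution st₀)                        ≡⟨ sum-cong-≗ (λ w → contribution-active st₀ w (initially-active w)) ⟩
    sum (λ w → vertexBound (t w) (deg G w))       ≡⟨ sum-cong-≗ (λ w → vertexBound-def (t w) (deg G w)) ⟩
    sum (λ w → ℚ.1ℚ ℚ.⊓ (+ t w ℚ./ suc (deg G w))) ≡⟨ sumFin≡sum n _ ⟨
    bound G t                                     ∎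
    where
    open ≡-Reasoning
    st₀ : MTSState n
    st₀ = initState G t

  initial-invariant : Invariant (initState G t)
  initial-invariant = record
    { S-removed         = λ _ → ⊥-lookup-elim
    ; δ-active          = λ u _ → ∣tabulate∣-cong λ w →
                            sym (trans (cong (adj G u w ∧_) (initially-active w)) (∧-identityʳ (adj G u w)))
    ; k-residual        = λ u _ → ℕ.m≤m+n (t u) _
    ; removed-activated = 0 , λ w ⊤w → contradiction (trans (sym (lookup-replicate w true)) ⊤w) λ ()
    ; rank              = λ _ → 0
    ; nextRank          = 0
    ; rank<nextRank     = λ _ → ⊥-lookup-elim
    ; k-pending         = λ _ _ → ⊥-lookup-elim
    ; potential≤bound   = ℚ.≤-reflexive initial-potential
    }

  nbrCount≤∣Γ∩∣ : ∀ u {P} X → (∀ w → P w ≡ true → w ∈ X) → nbrCount u P ≤ ∣ Γ G u ∩ X ∣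
  nbrCount≤∣Γ∩∣ u {P} X P⊆X = p⊆q⇒∣p∣≤∣q∣ {p = tabulate (λ w → adj G u w ∧ P w)} λ {w} w∈ →
    let uw , Pw = ∧-true⁻ (trans (sym (lookup∘tabulate _ w)) ([]=⇒lookup w∈)) in
    x∈p∩q⁺ (lookup⇒[]= w (Γ G u) (trans (lookup∘tabulate (adj G u) w) uw) , P⊆X w Pw)

  module Removal {st : MTSState n} (I : Invariant st) {v} (Uv : lookup (U st) v ≡ true) where
    open Invariant I

    U′ : Subset n
    U′ = U st - v

    U′-agrees : ∀ w → w ≢ v → lookup U′ w ≡ lookup (U st) w
    U′-agrees w w≢v = lookup-remove-other (U st) w≢v

    remaining : ∀ {u} → lookup U′ u ≡ true → lookup (U st) u ≡ true × u ≢ v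
    remaining {u} U′u with u ≟ v
    ... | yes refl = contradiction (trans (sym U′u) (lookup-remove-self (U st) v)) λ ()
    ... | no  u≢v  = trans (sym (U′-agrees u u≢v)) U′u , u≢v

    still-removed : ∀ w → lookup (U st) w ≡ false → lookup U′ w ≡ false
    still-removed w Uw with w ≟ v
    ... | yes refl = lookup-remove-self (U st) v
    ... | no  w≢v  = trans (U′-agrees w w≢v) Uw

    δ-active′ : ∀ u b → lookup U′ u ≡ true → b ≡ adj G u v ∧ active st v →
                (if b then δ st u ∸ 1 else δ st u) ≡ nbrCount u (λ w → lookup U′ w ∧ not (lookup (L st) w))
    δ-active′ u b U′u b≡ = δ-after-clear (active st) (λ w → lookup U′ w ∧ not (lookup (L st) w))
      (λ w w≢v → cong (_∧ not (lookup (L st) w)) (sym (U′-agrees w w≢v)))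
      (cong (_∧ not (lookup (L st) v)) (lookup-remove-self (U st) v)) b≡ (δ-active u (proj₁ (remaining U′u)))

    k-residual′ : ∀ u → lookup U′ u ≡ true → t u ≤ k (case1 G st v) u + nbrCount u (not ∘ lookup U′)
    k-residual′ u U′u = residual-after-clear (not ∘ lookup U′) (not ∘ lookup (U st))
      (λ w w≢v → cong not (U′-agrees w w≢v)) (cong not Uv) (cong not (lookup-remove-self (U st) v))
      (touched≡adj (U st) v Uu) (k-residual u Uu)
      where
      Uu : lookup (U st) u ≡ true
      Uu = proj₁ (remaining U′u)

    k-pending′ : ∀ u → lookup U′ u ≡ true → lookup (L st) u ≡ true →
                 k (case1 G st v) u ≤ nbrCount u (pending rank (case1 G st v) u)
    k-pending′ u U′u Lu = bound-after-clear (pending rank st u) (pending rank (case1 G st v) u)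
      (λ w w≢v → cong (_∧ later w) (sym (U′-agrees w w≢v))) (cong (_∧ later v) (lookup-remove-self (U st) v))
      (touched≡adj (U st) v Uu) (k-pending u Uu Lu)
      where
      Uu : lookup (U st) u ≡ true
      Uu = proj₁ (remaining U′u)
      later : Fin n → Bool
      later w = not (lookup (L st) w) ∨ (rank u <ᵇ rank w)

    -- c selects the neighbours whose δ is decremented; it differs between Cases 1 and 2
    after-removal : (Fin n → Bool) → MTSState n
    after-removal c = mkState (S st) (L st) U′ (k (case1 G st v)) (λ u → if c u then δ st u ∸ 1 else δ st u)

    contribution-after-removal : ∀ c → (∀ w → c w ≡ true → touched G (U st) v w ≡ true) → ∀ w →
                                 contribution (after-removal c) w ℚ.≤ contribution st w
    contribution-after-removal c c⇒touched w = contribution-mono st (after-removal c) w λ active′ →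
      let U′w , ¬Lw = ∧-true⁻ active′ in
      cong₂ _∧_ (proj₁ (remaining U′w)) ¬Lw ,
      vertexBound-decrement (touched G (U st) v w) (c w) (k st w) (δ st w) (c⇒touched w)

  invariant-case1 : ∀ {st v} → Invariant st → lookup (U st) v ≡ true → k st v ≡ 0 → Invariant (case1 G st v)
  invariant-case1 {st} {v} I Uv kv≡0 = record
    { S-removed         = λ w Sw → still-removed w (S-removed w Sw)
    ; δ-active          = λ u U′u → δ-active′ u _ U′u (decrement-condition u U′u)
    ; k-residual        = k-residual′
    ; removed-activated = suc ℓ , activated-now
    ; rank              = rank
    ; nextRank          = nextRank
    ; rank<nextRank     = rank<nextRank
    ; k-pending         = k-pending′
    ; potential≤bound   = ℚ.≤-trans (ℚ.+-monoʳ-≤ (+ ∣ S st ∣ ℚ./ 1) (sum-mono-≤ decreased)) potential≤bound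
    }
    where
    open Invariant I
    open Removal I Uv
    ℓ : ℕ
    ℓ = proj₁ removed-activated

    decrement-condition : ∀ u → lookup U′ u ≡ true →
                          touched G (U st) v u ∧ not (lookup (L st) v) ≡ adj G u v ∧ active st v
    decrement-condition u U′u = cong₂ _∧_ (touched≡adj (U st) v (proj₁ (remaining U′u)))
                                          (cong (_∧ not (lookup (L st) v)) (sym Uv))

    -- with k(v) = 0 the threshold of v is already met by its removed neighbours
    activated-now : ∀ w → lookup U′ w ≡ false → w ∈ activated G t (S st) (suc ℓ)
    activated-now w U′w with w ≟ v
    ... | yes refl = ∈-activated-threshold (S st) ℓ (ℕ.≤-trans t≤removed
      (nbrCount≤∣Γ∩∣ v _ λ x ¬Ux → proj₂ removed-activated x (not≡true⁻ ¬Ux)))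
      where
      t≤removed : t v ≤ nbrCount v (not ∘ lookup (U st))
      t≤removed = subst (λ κ → t v ≤ κ + nbrCount v (not ∘ lookup (U st))) kv≡0 (k-residual v Uv)
    ... | no  w≢v  = ∈-activated-suc (S st) ℓ (proj₂ removed-activated w (trans (sym (U′-agrees w w≢v)) U′w))

    decreased : ∀ w → contribution (case1 G st v) w ℚ.≤ contribution st w
    decreased = contribution-after-removal (λ u → touched G (U st) v u ∧ not (lookup (L st) v)) (λ _ → proj₁ ∘ ∧-true⁻)

  invariant-case2 : ∀ {st v} → Invariant st → lookup (U st) v ≡ true → lookup (L st) v ≡ false →
                    δ st v < k st v → Invariant (case2 G st v)
  invariant-case2 {st} {v} I Uv Lv δ<k = record
    { S-removed         = S-removed′
    ; δ-active          = λ u U′u → δ-active′ u _ U′u (decrement-condition u U′u)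
    ; k-residual        = k-residual′
    ; removed-activated = ℓ , activated-still
    ; rank              = rank
    ; nextRank          = nextRank
    ; rank<nextRank     = rank<nextRank
    ; k-pending         = k-pending′
    ; potential≤bound   = ℚ.≤-trans potential-decreases potential≤bound
    }
    where
    open Invariant I
    open Removal I Uv
    ℓ : ℕ
    ℓ = proj₁ removed-activated
    S′ : Subset n
    S′ = S st ∪ ⁅ v ⁆

    active-v : active st v ≡ true
    active-v = cong₂ _∧_ Uv (cong not Lv)

    Sv : lookup (S st) v ≡ false
    Sv with lookup (S st) v in Sv
    ... | false = refl
    ... | true  = contradiction (trans (sym Uv) (S-removed v Sv)) λ ()

    S-removed′ : ∀ w → lookup S′ w ≡ true → lookup U′ w ≡ false
    S-removed′ w S′w with w ≟ v
    ... | yes refl = lookup-remove-self (U st) v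
    ... | no  w≢v  = still-removed w (S-removed w (trans (sym (lookup-insert-other (S st) w≢v)) S′w))

    decrement-condition : ∀ u → lookup U′ u ≡ true → touched G (U st) v u ≡ adj G u v ∧ active st v
    decrement-condition u U′u = trans (touched≡adj (U st) v (proj₁ (remaining U′u)))
      (sym (trans (cong (adj G u v ∧_) active-v) (∧-identityʳ (adj G u v))))

    activated-still : ∀ w → lookup U′ w ≡ false → w ∈ activated G t S′ ℓ
    activated-still w U′w with w ≟ v
    ... | yes refl = ∈-activated-seed S′ ℓ (lookup⇒[]= v S′ (lookup-insert-self (S st) v))
    ... | no  w≢v  = activated-mono (p⊆p∪q ⁅ v ⁆) ℓ
                       (proj₂ removed-activated w (trans (sym (U′-agrees w w≢v)) U′w))

    indicator : Fin n → ℚ.ℚ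
    indicator w = if lookup ⁅ v ⁆ w then ℚ.1ℚ else ℚ.0ℚ

    -- as δ(v) < k(v), the contribution of v is min(1, k/(δ+1)) = 1, which pays for adding v to S
    exchange : ∀ w → indicator w ℚ.+ contribution (case2 G st v) w ℚ.≤ contribution st w
    exchange w with w ≟ v
    ... | yes refl = ℚ.≤-reflexive (begin
      indicator v ℚ.+ contribution (case2 G st v) v  ≡⟨ cong₂ ℚ._+_ (cong (if_then ℚ.1ℚ else ℚ.0ℚ) (lookup-⁅x⁆-x v))
                                                          (contribution-inactive (case2 G st v) v
                                                            (cong (_∧ not (lookup (L st) v)) (lookup-remove-self (U st) v))) ⟩
      ℚ.1ℚ ℚ.+ ℚ.0ℚ                                  ≡⟨ ℚ.+-identityʳ ℚ.1ℚ ⟩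
      ℚ.1ℚ                                           ≡⟨ vertexBound-saturated (k st v) (δ st v) δ<k ⟨
      vertexBound (k st v) (δ st v)                  ≡⟨ contribution-active st v active-v ⟨
      contribution st v                              ∎)
      where open ≡-Reasoning
    ... | no  w≢v  = begin
      indicator w ℚ.+ contribution (case2 G st v) w  ≡⟨ cong (ℚ._+ contribution (case2 G st v) w)
                                                          (cong (if_then ℚ.1ℚ else ℚ.0ℚ) (lookup-⁅x⁆-y w≢v)) ⟩
      ℚ.0ℚ ℚ.+ contribution (case2 G st v) w         ≡⟨ ℚ.+-identityˡ (contribution (case2 G st v) w) ⟩
      contribution (case2 G st v) w                  ≤⟨ contribution-after-removal (touched G (U st) v) (λ _ t → t) w ⟩
      contribution st w                              ∎
      where open ℚ.≤-Reasoning

    potential-decreases : potential (case2 G st v) ℚ.≤ potential st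
    potential-decreases = begin
      + ∣ S′ ∣ ℚ./ 1 ℚ.+ ∑c′                   ≡⟨ cong (λ m → + m ℚ./ 1 ℚ.+ ∑c′) (∣p∪⁅x⁆∣≡1+∣p∣ (S st) Sv) ⟩
      + suc s ℚ./ 1 ℚ.+ ∑c′                    ≡⟨ cong (ℚ._+ ∑c′) (/-distribʳ-+ 1 s 0) ⟩
      (ℚ.1ℚ ℚ.+ + s ℚ./ 1) ℚ.+ ∑c′             ≡⟨ cong (ℚ._+ ∑c′) (ℚ.+-comm ℚ.1ℚ (+ s ℚ./ 1)) ⟩
      (+ s ℚ./ 1 ℚ.+ ℚ.1ℚ) ℚ.+ ∑c′             ≡⟨ ℚ.+-assoc (+ s ℚ./ 1) ℚ.1ℚ ∑c′ ⟩
      + s ℚ./ 1 ℚ.+ (ℚ.1ℚ ℚ.+ ∑c′)             ≡⟨ cong (λ x → + s ℚ./ 1 ℚ.+ (x ℚ.+ ∑c′)) ∑indicator ⟨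
      + s ℚ./ 1 ℚ.+ (sum indicator ℚ.+ ∑c′)    ≡⟨ cong (+ s ℚ./ 1 ℚ.+_) (∑-distrib-+ indicator (contribution (case2 G st v))) ⟨
      + s ℚ./ 1 ℚ.+ sum (λ w → indicator w ℚ.+ contribution (case2 G st v) w)
                                               ≤⟨ ℚ.+-monoʳ-≤ (+ s ℚ./ 1) (sum-mono-≤ exchange) ⟩
      potential st                             ∎
      where
      open ℚ.≤-Reasoning
      s : ℕ
      s = ∣ S st ∣
      ∑c′ : ℚ.ℚ
      ∑c′ = sum (contribution (case2 G st v))
      ∑indicator : sum indicator ≡ ℚ.1ℚ
      ∑indicator = sum-indicator-single (lookup ⁅ v ⁆) ℚ.1ℚ (∣tabulate-lookup-⁅x⁆∣≡1 v)

  invariant-case3 : ∀ {st v} → Invariant st → active st v ≡ true →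
                    (∀ u → active st u ≡ true → 1 ≤ k st u × k st u ≤ δ st u) →
                    (∀ u → active st u ≡ true → RatioLe st u v) → Invariant (case3 G st v)
  invariant-case3 {st} {v} I active-v bounded maximal = record
    { S-removed         = S-removed
    ; δ-active          = δ-active′
    ; k-residual        = k-residual
    ; removed-activated = removed-activated
    ; rank              = rank′
    ; nextRank          = suc nextRank
    ; rank<nextRank     = rank<nextRank′
    ; k-pending         = k-pending′
    ; potential≤bound   = ℚ.≤-trans potential-decreases potential≤bound
    }
    where
    open Invariant I
    st′ : MTSState n
    st′ = case3 G st v
    L′ : Subset n
    L′ = L st ∪ ⁅ v ⁆
    Uv : lookup (U st) v ≡ true
    Uv = proj₁ (active⁻ st v active-v)

    active′-agrees : ∀ w → w ≢ v → active st w ≡ active st′ w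
    active′-agrees w w≢v = cong (λ b → lookup (U st) w ∧ not b) (sym (lookup-insert-other (L st) w≢v))

    active′-v : active st′ v ≡ false
    active′-v = trans (cong (λ b → lookup (U st) v ∧ not b) (lookup-insert-self (L st) v)) (∧-zeroʳ (lookup (U st) v))

    δ-active′ : ∀ u → lookup (U st) u ≡ true → δ st′ u ≡ nbrCount u (active st′)
    δ-active′ u Uu = δ-after-clear (active st) (active st′) active′-agrees active′-v
      (trans (touched≡adj (U st) v Uu) (sym (trans (cong (adj G u v ∧_) active-v) (∧-identityʳ (adj G u v)))))
      (δ-active u Uu)

    rank′ : Fin n → ℕ
    rank′ w = if lookup ⁅ v ⁆ w then nextRank else rank w

    rank′-v : rank′ v ≡ nextRank
    rank′-v = cong (if_then nextRank else rank v) (lookup-⁅x⁆-x v)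

    rank′-other : ∀ {w} → w ≢ v → rank′ w ≡ rank w
    rank′-other {w} w≢v = cong (if_then nextRank else rank w) (lookup-⁅x⁆-y w≢v)

    rank<nextRank′ : ∀ u → lookup L′ u ≡ true → rank′ u < suc nextRank
    rank<nextRank′ u L′u with u ≟ v
    ... | yes refl = subst (_< suc nextRank) (sym rank′-v) (ℕ.n<1+n nextRank)
    ... | no  u≢v  = subst (_< suc nextRank) (sym (rank′-other u≢v))
                       (ℕ.m≤n⇒m≤1+n (rank<nextRank u (trans (sym (lookup-insert-other (L st) u≢v)) L′u)))

    k-pending′ : ∀ u → lookup (U st) u ≡ true → lookup L′ u ≡ true → k st u ≤ nbrCount u (pending rank′ st′ u)
    k-pending′ u Uu L′u with u ≟ v
    ... | yes refl = begin
      k st v                       ≤⟨ proj₂ (bounded v active-v) ⟩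
      δ st v                       ≡⟨ δ-active v Uv ⟩
      nbrCount v (active st)       ≤⟨ nbrCount-mono v entering ⟩
      nbrCount v (pending rank′ st′ v) ∎
      where
      open ℕ.≤-Reasoning
      entering : ∀ w → adj G v w ≡ true → active st w ≡ true → pending rank′ st′ v w ≡ true
      entering w vw active-w with w ≟ v
      ... | yes refl = contradiction (trans (sym vw) (loopless G v)) λ ()
      ... | no  w≢v rewrite lookup-insert-other (L st) w≢v | proj₁ (active⁻ st w active-w)
                          | proj₂ (active⁻ st w active-w) = refl
    ... | no  u≢v  = ℕ.≤-trans (k-pending u Uu Lu) (nbrCount-mono u still-pending)
      where
      Lu : lookup (L st) u ≡ true
      Lu = trans (sym (lookup-insert-other (L st) u≢v)) L′u
      still-pending : ∀ w → adj G u w ≡ true → pending rank st u w ≡ true → pending rank′ st′ u w ≡ true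
      still-pending w _ pending-w with w ≟ v
      ... | yes refl rewrite lookup-insert-self (L st) v | rank′-v | rank′-other u≢v | Uv =
        <⇒<ᵇ≡true (rank<nextRank u Lu)
      ... | no  w≢v  rewrite lookup-insert-other (L st) w≢v | rank′-other u≢v | rank′-other w≢v = pending-w

    k≤δ-v : k st v ≤ δ st v
    k≤δ-v = proj₂ (bounded v active-v)

    δv-suc : ∃ λ e → δ st v ≡ suc e
    δv-suc with δ st v | ℕ.≤-trans (proj₁ (bounded v active-v)) k≤δ-v
    ... | suc e | _ = e , refl

    e : ℕ
    e = proj₁ δv-suc
    δv≡ : δ st v ≡ suc e
    δv≡ = proj₂ δv-suc

    x : ℚ.ℚ
    x = share (k st v) e

    v-indicator neighbour-indicator : Fin n → ℚ.ℚ
    v-indicator w = if lookup ⁅ v ⁆ w then vertexBound (k st v) (δ st v) else ℚ.0ℚ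
    neighbour-indicator w = if adj G v w ∧ active st w then x else ℚ.0ℚ

    adjacent-drop : ∀ w → active st w ≡ true →
                    vertexBound (k st w) (δ st w ∸ 1) ℚ.≤ vertexBound (k st w) (δ st w) ℚ.+ x
    adjacent-drop w active-w with δ st w | proj₁ (bounded w active-w) | proj₂ (bounded w active-w) | maximal w active-w
    ... | zero  | 1≤k | k≤0   | _     = contradiction (ℕ.≤-trans 1≤k k≤0) λ ()
    ... | suc m | _   | k≤1+m | ratio = vertexBound≤vertexBound-suc+share (k st w) m (k st v) e k≤1+m
                                        (subst (λ d → k st w * (d * suc d) ≤ k st v * (suc m * suc (suc m))) δv≡ ratio)

    neighbour-bound : ∀ w → w ≢ v → contribution st′ w ℚ.≤ contribution st w ℚ.+ neighbour-indicator w
    neighbour-bound w w≢v = by-cases (active st w) (adj G v w) refl refl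
      where
      open ℚ.≤-Reasoning
      by-cases : ∀ a b → active st w ≡ a → adj G v w ≡ b →
                 contribution st′ w ℚ.≤ contribution st w ℚ.+ neighbour-indicator w
      by-cases false _ inactive-w _ = begin
        contribution st′ w                            ≡⟨ contribution-inactive st′ w (trans (sym (active′-agrees w w≢v)) inactive-w) ⟩
        ℚ.0ℚ                                          ≤⟨ ℚ.+-mono-≤ (0≤contribution st w) (ℚ.≤-reflexive (sym ind≡0)) ⟩
        contribution st w ℚ.+ neighbour-indicator w   ∎
        where
        ind≡0 : neighbour-indicator w ≡ ℚ.0ℚ
        ind≡0 = cong (if_then x else ℚ.0ℚ) (trans (cong (adj G v w ∧_) inactive-w) (∧-zeroʳ (adj G v w)))
      by-cases true false active-w vw = begin
        contribution st′ w                            ≡⟨ contribution-active st′ w (trans (sym (active′-agrees w w≢v)) active-w) ⟩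
        vertexBound (k st w) (δ st′ w)                ≡⟨ cong (λ b → vertexBound (k st w) (if b ∧ lookup (U st) w then δ st w ∸ 1 else δ st w)) vw ⟩
        vertexBound (k st w) (δ st w)                 ≡⟨ contribution-active st w active-w ⟨
        contribution st w                             ≡⟨ ℚ.+-identityʳ (contribution st w) ⟨
        contribution st w ℚ.+ ℚ.0ℚ                    ≡⟨ cong (λ b → contribution st w ℚ.+ (if b ∧ active st w then x else ℚ.0ℚ)) vw ⟨
        contribution st w ℚ.+ neighbour-indicator w   ∎
      by-cases true true active-w vw = begin
        contribution st′ w                            ≡⟨ contribution-active st′ w (trans (sym (active′-agrees w w≢v)) active-w) ⟩
        vertexBound (k st w) (δ st′ w)                ≡⟨ cong₂ (λ a b → vertexBound (k st w) (if a ∧ b then δ st w ∸ 1 else δ st w))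
                                                           vw (proj₁ (active⁻ st w active-w)) ⟩
        vertexBound (k st w) (δ st w ∸ 1)             ≤⟨ adjacent-drop w active-w ⟩
        vertexBound (k st w) (δ st w) ℚ.+ x           ≡⟨ cong₂ ℚ._+_ (contribution-active st w active-w)
                                                          (cong₂ (λ a b → if a ∧ b then x else ℚ.0ℚ) vw active-w) ⟨
        contribution st w ℚ.+ neighbour-indicator w   ∎

    vb-v : ℚ.ℚ
    vb-v = vertexBound (k st v) (δ st v)

    -- v hands one share x to each active neighbour, which covers the growth of the neighbour's term
    exchange : ∀ w → contribution st′ w ℚ.+ v-indicator w ℚ.≤ contribution st w ℚ.+ neighbour-indicator w
    exchange w with w ≟ v
    ... | yes refl = ℚ.≤-reflexive (begin
      contribution st′ v ℚ.+ v-indicator v         ≡⟨ cong₂ ℚ._+_ (contribution-inactive st′ v active′-v)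
                                                         (cong (if_then vb-v else ℚ.0ℚ) (lookup-⁅x⁆-x v)) ⟩
      ℚ.0ℚ ℚ.+ vb-v                                ≡⟨ ℚ.+-identityˡ vb-v ⟩
      vb-v                                         ≡⟨ ℚ.+-identityʳ vb-v ⟨
      vb-v ℚ.+ ℚ.0ℚ                                ≡⟨ cong₂ ℚ._+_ (contribution-active st v active-v)
                                                         (cong (λ b → if b ∧ active st v then x else ℚ.0ℚ) (loopless G v)) ⟨
      contribution st v ℚ.+ neighbour-indicator v  ∎)
      where open ≡-Reasoning
    ... | no  w≢v  = begin
      contribution st′ w ℚ.+ v-indicator w         ≡⟨ cong (contribution st′ w ℚ.+_) (cong (if_then vb-v else ℚ.0ℚ) (lookup-⁅x⁆-y w≢v)) ⟩
      contribution st′ w ℚ.+ ℚ.0ℚ                  ≡⟨ ℚ.+-identityʳ (contribution st′ w) ⟩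
      contribution st′ w                           ≤⟨ neighbour-bound w w≢v ⟩
      contribution st w ℚ.+ neighbour-indicator w  ∎
      where open ℚ.≤-Reasoning

    ∑v-indicator : sum v-indicator ≡ vb-v
    ∑v-indicator = sum-indicator-single (lookup ⁅ v ⁆) vb-v (∣tabulate-lookup-⁅x⁆∣≡1 v)

    ∑neighbour-indicator : sum neighbour-indicator ≡ vb-v
    ∑neighbour-indicator = trans
      (sum-indicator-share (λ w → adj G v w ∧ active st w) (k st v) e (trans (sym (δ-active v Uv)) δv≡)
                            (subst (k st v ≤_) δv≡ k≤δ-v))
      (cong (vertexBound (k st v)) (sym δv≡))

    potential-decreases : potential st′ ℚ.≤ potential st
    potential-decreases = ℚ.+-monoʳ-≤ (+ ∣ S st ∣ ℚ./ 1) (+-cancelʳ-≤ vb-v (begin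
      sum (contribution st′) ℚ.+ vb-v                  ≡⟨ cong (sum (contribution st′) ℚ.+_) ∑v-indicator ⟨
      sum (contribution st′) ℚ.+ sum v-indicator       ≡⟨ ∑-distrib-+ (contribution st′) v-indicator ⟨
      sum (λ w → contribution st′ w ℚ.+ v-indicator w) ≤⟨ sum-mono-≤ exchange ⟩
      sum (λ w → contribution st w ℚ.+ neighbour-indicator w)
                                                       ≡⟨ ∑-distrib-+ (contribution st) neighbour-indicator ⟩
      sum (contribution st) ℚ.+ sum neighbour-indicator ≡⟨ cong (sum (contribution st) ℚ.+_) ∑neighbour-indicator ⟩
      sum (contribution st) ℚ.+ vb-v                   ∎))
      where open ℚ.≤-Reasoning

  InUL⇒active : ∀ st u → InUL st u → active st u ≡ true
  InUL⇒active st u (u∈U , u∉L) = cong₂ _∧_ ([]=⇒lookup u∈U) (cong not (lookup-∉ u∉L))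

  active⇒InUL : ∀ st u → active st u ≡ true → InUL st u
  active⇒InUL st u active-u =
    lookup⇒[]= u (U st) Uu , λ u∈L → contradiction (trans (sym ([]=⇒lookup u∈L)) Lu) λ ()
    where
    Uu : lookup (U st) u ≡ true
    Uu = proj₁ (active⁻ st u active-u)
    Lu : lookup (L st) u ≡ false
    Lu = proj₂ (active⁻ st u active-u)

  step-preserves-invariant : ∀ {st st′} → Invariant st → Step G st st′ → Invariant st′
  step-preserves-invariant I (step1 st v v∈U kv≡0) = invariant-case1 I ([]=⇒lookup v∈U) kv≡0
  step-preserves-invariant I (step2 st v _ (v∈U , v∉L) δ<k) =
    invariant-case2 I ([]=⇒lookup v∈U) (lookup-∉ v∉L) δ<k
  step-preserves-invariant I (step3 st v k≢0 δ≮k v∈U∖L maximal) =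
    invariant-case3 I (InUL⇒active st v v∈U∖L) bounded (λ u active-u → maximal u (active⇒InUL st u active-u))
    where
    bounded : ∀ u → active st u ≡ true → 1 ≤ k st u × k st u ≤ δ st u
    bounded u active-u = ℕ.n≢0⇒n>0 (k≢0 u (proj₁ u∈U∖L)) , ℕ.≮⇒≥ (δ≮k u u∈U∖L)
      where
      u∈U∖L : InUL st u
      u∈U∖L = active⇒InUL st u active-u

  reachable-invariant : ∀ {st} → Reachable G t st → Invariant st
  reachable-invariant start          = initial-invariant
  reachable-invariant (next r _ step) = step-preserves-invariant (reachable-invariant r) step

  -- once U ⊆ L, the vertex of U that entered L last has no pending neighbours, so its k is 0
  last-entered-k≡0 : ∀ {st u₀} → Invariant st → (∀ u → active st u ≡ false) → lookup (U st) u₀ ≡ true →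
                     ∃ λ u → lookup (U st) u ≡ true × k st u ≡ 0
  last-entered-k≡0 {st} I inactive Uu₀ =
    u , Uu , ℕ.n≤0⇒n≡0 (subst (k st u ≤_) (∣tabulate∣-false no-pending) (k-pending u Uu (in-L u Uu)))
    where
    open Invariant I
    latest : ∃ (IsMaximum (lookup (U st)) (λ a b → rank a ≤ rank b))
    latest = argmax (lookup (U st)) (λ a b → rank a ≤ rank b)
                    (λ {a} {b} _ _ → ℕ.≤-total (rank a) (rank b)) (λ _ → ℕ.≤-trans) Uu₀
    u : Fin n
    u = proj₁ latest
    Uu : lookup (U st) u ≡ true
    Uu = proj₁ (proj₂ latest)
    in-L : ∀ w → lookup (U st) w ≡ true → lookup (L st) w ≡ true
    in-L w Uw with lookup (L st) w in Lw
    ... | true  = refl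
    ... | false = contradiction (trans (sym (inactive w)) (cong₂ _∧_ Uw (cong not Lw))) λ ()
    no-pending : ∀ w → adj G u w ∧ pending rank st u w ≡ false
    no-pending w with lookup (U st) w in Uw
    ... | false = ∧-zeroʳ (adj G u w)
    ... | true  rewrite in-L w Uw | ≤⇒<ᵇ≡false (proj₂ (proj₂ latest) w Uw) = ∧-zeroʳ (adj G u w)

  U-nonempty : ∀ {st : MTSState n} → ¬ U st ≡ ⊥ → ∃ λ u → lookup (U st) u ≡ true
  U-nonempty {st} U≢⊥ with nonempty? (U st)
  ... | yes (u , u∈U) = u , []=⇒lookup u∈U
  ... | no  ∄u        = contradiction (Empty-unique ∄u) U≢⊥

  ratio-nonZero : ∀ a d → 1 ≤ a → a ≤ d → NonZero (a * (d * suc d))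
  ratio-nonZero (suc a) (suc d) _ _ = _

  step3-exists : ∀ {st} → Invariant st → ¬ U st ≡ ⊥ → (∀ u → u ∈ U st → ¬ k st u ≡ 0) →
                 (∀ u → InUL st u → ¬ δ st u < k st u) → ∃ (Step G st)
  step3-exists {st} I U≢⊥ k≢0 δ≮k with any? (λ u → active st u Bool.≟ true)
  ... | yes (_ , active-v₀) =
    case3 G st v , step3 st v k≢0 δ≮k (active⇒InUL st v active-v) (λ u u∈U∖L → v-max u (InUL⇒active st u u∈U∖L))
    where
    ratio-total : ∀ {a b} → active st a ≡ true → active st b ≡ true → RatioLe st a b ⊎ RatioLe st b a
    ratio-total {a} {b} _ _ = ℕ.≤-total _ _
    ratio-trans : ∀ {a b c} → active st b ≡ true → RatioLe st a b → RatioLe st b c → RatioLe st a c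
    ratio-trans {a} {b} {c} active-b = cross-≤-trans (k st a) (k st b) (k st c) (D a) (D b) (D c)
      {{ratio-nonZero (k st b) (δ st b) (ℕ.n≢0⇒n>0 (k≢0 b (proj₁ b∈U∖L))) (ℕ.≮⇒≥ (δ≮k b b∈U∖L))}}
      where
      D : Fin n → ℕ
      D w = δ st w * suc (δ st w)
      b∈U∖L : InUL st b
      b∈U∖L = active⇒InUL st b active-b
    maximum : ∃ (IsMaximum (active st) (RatioLe st))
    maximum = argmax (active st) (RatioLe st) ratio-total ratio-trans active-v₀
    v : Fin n
    v = proj₁ maximum
    active-v : active st v ≡ true
    active-v = proj₁ (proj₂ maximum)
    v-max : ∀ u → active st u ≡ true → RatioLe st u v
    v-max = proj₂ (proj₂ maximum)
  ... | no ∄active =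
    let u , Uu , ku≡0 = last-entered-k≡0 I inactive (proj₂ (U-nonempty {st} U≢⊥))
    in contradiction ku≡0 (k≢0 u (lookup⇒[]= u (U st) Uu))
    where
    inactive : ∀ w → active st w ≡ false
    inactive w with active st w in active-w
    ... | false = refl
    ... | true  = contradiction (w , active-w) ∄active

  step2-or-3-exists : ∀ {st} → Invariant st → ¬ U st ≡ ⊥ → (∀ u → u ∈ U st → ¬ k st u ≡ 0) → ∃ (Step G st)
  step2-or-3-exists {st} I U≢⊥ k≢0 with any? (λ u → active st u Bool.≟ true ×-dec δ st u ℕ.<? k st u)
  ... | yes (v , active-v , δ<k) = case2 G st v , step2 st v k≢0 (active⇒InUL st v active-v) δ<k
  ... | no  ∄δ<k = step3-exists I U≢⊥ k≢0 λ u u∈U∖L δ<k → ∄δ<k (u , InUL⇒active st u u∈U∖L , δ<k)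

  step-exists : ∀ {st} → Invariant st → ¬ U st ≡ ⊥ → ∃ (Step G st)
  step-exists {st} I U≢⊥ with any? (λ u → lookup (U st) u Bool.≟ true ×-dec k st u ℕ.≟ 0)
  ... | yes (v , Uv , kv≡0) = case1 G st v , step1 st v (lookup⇒[]= v (U st) Uv) kv≡0
  ... | no  ∄k≡0 = step2-or-3-exists I U≢⊥ λ u u∈U k≡0 → ∄k≡0 (u , []=⇒lookup u∈U , k≡0)

  final-state : ∀ {st} → Invariant st → U st ≡ ⊥ →
                IsTargetSet G t (S st) × (+ ∣ S st ∣ ℚ./ 1) ℚ.≤ bound G t
  final-state {st} I U≡⊥ =
    (proj₁ removed-activated , ⊆-antisym ⊆⊤ (λ {w} _ → proj₂ removed-activated w (removed w))) ,
    ℚ.≤-trans (ℚ.≤-reflexive |S|≡potential) potential≤bound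
    where
    open Invariant I
    removed : ∀ w → lookup (U st) w ≡ false
    removed w = trans (cong (λ p → lookup p w) U≡⊥) (lookup-replicate w false)
    no-contribution : sum (contribution st) ≡ ℚ.0ℚ
    no-contribution = trans (sum-cong-≗ λ w → contribution-inactive st w (cong (_∧ not (lookup (L st) w)) (removed w)))
                            (sum-replicate-zero n)
    |S|≡potential : + ∣ S st ∣ ℚ./ 1 ≡ potential st
    |S|≡potential = sym (trans (cong (+ ∣ S st ∣ ℚ./ 1 ℚ.+_) no-contribution) (ℚ.+-identityʳ (+ ∣ S st ∣ ℚ./ 1)))

theorem5 : ∀ {n : ℕ} (G : Graph n) (t : Thresholds n) →
    (∀ st → Reachable G t st → ¬ (U st ≡ ⊥) → ∃ λ st' → Step G st st')
    × (∀ st → Reachable G t st → U st ≡ ⊥ →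
         IsTargetSet G t (S st) × (+ ∣ S st ∣ ℚ./ 1) ℚ.≤ bound G t)
theorem5 G t =
  (λ _ reachable U≢⊥ → step-exists G t (reachable-invariant G t reachable) U≢⊥) ,
  (λ _ reachable U≡⊥ → final-state G t (reachable-invariant G t reachable) U≡⊥)
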